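{- $\mathsf{FindWS}_{\boldsymbol\Pi}\equiv_{\mathrm W}\mathsf{C}_{\mathbb{N}^\mathbb{N}}$.
   Context: A represented space is a set $X$ with a partial surjection $\delta_X:\subseteq\mathbb{N}^\mathbb{N}\to X$ (names). A partial $F$ realizes a partial multivalued $f:\subseteq X\rightrightarrows Y$ if for every $x\in\operatorname{dom}(f)$ and name $p$ of $x$, $F(p)$ names an element of $f(x)$. $f\le_{\mathrm W}g$ if there are computable partial $H,K:\subseteq\mathbb{N}^\mathbb{N}\to\mathbb{N}^\mathbb{N}$ such that for every realizer $G$ of $g$, $p\mapsto K(\langle p,G(H(p))\rangle)$ realizes $f$; $\equiv_{\mathrm W}$ is mutual reducibility. $\mathsf{C}_{\mathbb{N}^\mathbb{N}}$: given (the characteristic function of) a tree $T\subseteq\mathbb{N}^{<\mathbb{N}}$ with nonempty set of infinite paths $[T]$, output some element of $[T]$. $\mathcal{O}(\mathbb{N}^\mathbb{N})$ is the space of open subsets $U$ of $\mathbb{N}^\mathbb{N}$, a name of $U$ being an enumeration of finite strings $w_0,w_1,\dots$ (possibly with a placeholder for "nothing") with $U=\bigcup_i w_i\mathbb{N}^\mathbb{N}$. For $W\in\mathcal{O}(\mathbb{N}^\mathbb{N})$, the game $G(W)$: Players 1 and 2 alternately choose natural numbers, Player 1 first, producing $x\in\mathbb{N}^\mathbb{N}$; Player 1 wins iff $x\in W$. Strategies are functions from finite sequences to $\mathbb{N}$, coded as elements of $\mathbb{N}^\mathbb{N}$. $\mathsf{FindWS}_{\boldsymbol\Pi}:\subseteq\mathcal{O}(\mathbb{N}^\mathbb{N})\rightrightarrows\mathbb{N}^\mathbb{N}$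 is defined on those $W$ for which Player 1 has no winning strategy in $G(W)$, and maps $W$ to the set of winning strategies of Player 2. -}

module Defs where

open import Level using (Level; 0ℓ) renaming (suc to lsuc; _⊔_ to _⊔ℓ_)
open import Data.Nat using (ℕ; zero; suc; _+_; _*_; _<_)
open import Data.Fin using (Fin)
open import Data.Vec using (Vec; []; _∷_; lookup)
open import Data.List using (List; []; _∷_; _++_; length; applyUpTo)
open import Data.Bool using (Bool; true; false; if_then_else_)
open import Data.Product using (Σ; _×_; _,_; ∃)
open import Relation.Nullary using (¬_)
open import Relation.Binary.PropositionalEquality using (_≡_)

Baire : Set
Baire = ℕ → ℕ

-- ⟨p , q⟩ : interleaving, ⟨p,q⟩(2n) = p n, ⟨p,q⟩(2n+1) = q n
⟨_,_⟩ : Baire → Baire → Baire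
⟨ p , q ⟩ zero          = p zero
⟨ p , q ⟩ (suc zero)    = q zero
⟨ p , q ⟩ (suc (suc n)) = ⟨ (λ i → p (suc i)) , (λ i → q (suc i)) ⟩ n

_↾_ : Baire → ℕ → List ℕ
x ↾ n = applyUpTo x n

-- Coding of finite sequences by natural numbers (a bijection List ℕ ≅ ℕ)

tri : ℕ → ℕ
tri zero    = zero
tri (suc n) = suc n + tri n

cantor : ℕ → ℕ → ℕ
cantor a b = tri (a + b) + b

code : List ℕ → ℕ
code []      = zero
code (a ∷ s) = suc (cantor a (code s))

-- Oracle partial recursive functions (Kleene's μ-recursive functions
-- relative to an oracle α : ℕ → ℕ)

data PR : ℕ → Set where
  zer  : ∀ {n} → PR n
  sc   : PR 1
  proj : ∀ {n} → Fin n → PR n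
  comp : ∀ {m n} → PR m → Vec (PR n) m → PR n
  prec : ∀ {n} → PR n → PR (suc (suc n)) → PR (suc n)
  mu   : ∀ {n} → PR (suc n) → PR n
  orc  : PR 1

mutual
  data _⊢_[_]⇓_ (α : Baire) : ∀ {n} → PR n → Vec ℕ n → ℕ → Set where
    e-zer  : ∀ {n} {xs : Vec ℕ n} → α ⊢ zer [ xs ]⇓ zero
    e-sc   : ∀ {x} → α ⊢ sc [ x ∷ [] ]⇓ suc x
    e-proj : ∀ {n} {i : Fin n} {xs} → α ⊢ proj i [ xs ]⇓ lookup xs i
    e-comp : ∀ {m n} {f : PR m} {gs : Vec (PR n) m} {xs ys y} →
             EvalAll α gs xs ys → α ⊢ f [ ys ]⇓ y → α ⊢ comp f gs [ xs ]⇓ y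
    e-prec0 : ∀ {n} {f : PR n} {g} {xs y} →
             α ⊢ f [ xs ]⇓ y → α ⊢ prec f g [ zero ∷ xs ]⇓ y
    e-precS : ∀ {n} {f : PR n} {g} {xs k r y} →
             α ⊢ prec f g [ k ∷ xs ]⇓ r → α ⊢ g [ k ∷ r ∷ xs ]⇓ y →
             α ⊢ prec f g [ suc k ∷ xs ]⇓ y
    e-mu   : ∀ {n} {f : PR (suc n)} {xs y} →
             α ⊢ f [ y ∷ xs ]⇓ zero →
             (∀ z → z < y → Σ ℕ λ k → α ⊢ f [ z ∷ xs ]⇓ suc k) →
             α ⊢ mu f [ xs ]⇓ y
    e-orc  : ∀ {x} → α ⊢ orc [ x ∷ [] ]⇓ α x

  data EvalAll (α : Baire) {n : ℕ} : ∀ {m} → Vec (PR n) m → Vec ℕ n → Vec ℕ m → Set where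
    []  : ∀ {xs} → EvalAll α [] xs []
    _∷_ : ∀ {m} {g : PR n} {gs : Vec (PR n) m} {xs y ys} →
          α ⊢ g [ xs ]⇓ y → EvalAll α gs xs ys → EvalAll α (g ∷ gs) xs (y ∷ ys)

Computes : PR 1 → Baire → Baire → Set
Computes c p q = ∀ n → p ⊢ c [ n ∷ [] ]⇓ q n

record RepSpace (a : Level) : Set (lsuc a) where
  field
    Carrier : Set a
    Names   : Baire → Carrier → Set

open RepSpace public

record MVF {a b : Level} (X : RepSpace a) (Y : RepSpace b) : Set (lsuc 0ℓ ⊔ℓ a ⊔ℓ b) where
  field
    dom : Carrier X → Set
    rel : Carrier X → Carrier Y → Set

open MVF public

Realizes : ∀ {a b} {X : RepSpace a} {Y : RepSpace b} → MVF X Y →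
           (DomF : Baire → Set) → ((p : Baire) → DomF p → Baire) → Set (a ⊔ℓ b)
Realizes {X = X} {Y} f DomF F =
  ∀ x → dom f x → ∀ p → Names X p x →
  Σ (DomF p) λ d → Σ (Carrier Y) λ y → rel f x y × Names Y (F p d) y

_≤W_ : ∀ {a b c d} {X : RepSpace a} {Y : RepSpace b} {Z : RepSpace c} {V : RepSpace d} →
       MVF X Y → MVF Z V → Set (lsuc 0ℓ ⊔ℓ a ⊔ℓ b ⊔ℓ c ⊔ℓ d)
_≤W_ {X = X} {Y} {Z} {V} f g =
  Σ (PR 1) λ h → Σ (PR 1) λ k →
  (DomG : Baire → Set) (G : (q : Baire) → DomG q → Baire) → Realizes g DomG G →
  ∀ x → dom f x → ∀ p → Names X p x →
  Σ Baire λ q → Computes h p q ×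
  Σ (DomG q) λ dq → Σ Baire λ s → Computes k ⟨ p , G q dq ⟩ s ×
  Σ (Carrier Y) λ y → rel f x y × Names Y s y

_≡W_ : ∀ {a b c d} {X : RepSpace a} {Y : RepSpace b} {Z : RepSpace c} {V : RepSpace d} →
       MVF X Y → MVF Z V → Set (lsuc 0ℓ ⊔ℓ a ⊔ℓ b ⊔ℓ c ⊔ℓ d)
f ≡W g = (f ≤W g) × (g ≤W f)

BaireSp : RepSpace 0ℓ
BaireSp = record { Carrier = Baire ; Names = λ p x → ∀ n → p n ≡ x n }

char : Bool → ℕ
char true  = 1
char false = 0

SubSeqSp : RepSpace 0ℓ
SubSeqSp = record { Carrier = List ℕ → Bool
                  ; Names = λ p T → ∀ s → p (code s) ≡ char (T s) }

_≺_ : List ℕ → Baire → Set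
w ≺ x = w ≡ x ↾ length w

-- O(ℕ^ℕ): a name of U is an enumeration of strings (0 = placeholder,
-- suc (code w) = the string w) whose cylinders union to U
OpenSp : RepSpace (lsuc 0ℓ)
OpenSp = record
  { Carrier = Baire → Set
  ; Names = λ p U → ∀ x →
      (U x → Σ ℕ λ i → Σ (List ℕ) λ w → (p i ≡ suc (code w)) × (w ≺ x)) ×
      ((Σ ℕ λ i → Σ (List ℕ) λ w → (p i ≡ suc (code w)) × (w ≺ x)) → U x)
  }

IsTree : (List ℕ → Bool) → Set
IsTree T = ∀ s t → T (s ++ t) ≡ true → T s ≡ true

IsPath : (List ℕ → Bool) → Baire → Set
IsPath T x = ∀ n → T (x ↾ n) ≡ true

C-Baire : MVF SubSeqSp BaireSp
C-Baire = record
  { dom = λ T → IsTree T × (Σ Baire λ x → IsPath T x)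
  ; rel = λ T x → IsPath T x }

Strategy : Set
Strategy = List ℕ → ℕ

P1Consistent : Strategy → Baire → Set
P1Consistent σ x = ∀ n → x (2 * n) ≡ σ (x ↾ (2 * n))

P2Consistent : Strategy → Baire → Set
P2Consistent σ x = ∀ n → x (suc (2 * n)) ≡ σ (x ↾ suc (2 * n))

P1Winning : (Baire → Set) → Strategy → Set
P1Winning W σ = ∀ x → P1Consistent σ x → W x

P2Winning : (Baire → Set) → Strategy → Set
P2Winning W σ = ∀ x → P2Consistent σ x → ¬ W x

decodeStrat : Baire → Strategy
decodeStrat p s = p (code s)

FindWS-Π : MVF OpenSp BaireSp
FindWS-Π = record
  { dom = λ W → ¬ (Σ Strategy λ σ → P1Winning W σ)
  ; rel = λ W p → P2Winning W (decodeStrat p) }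

-- From an enumeration p of an open set W we compute
-- the tree of unrefuted strategy prefixes: a string s of values of a point
-- coding a Player 2 strategy is refuted when some position coded below |s|,
-- in which Player 2 moved as s prescribes, extends a string enumerated by
-- p below |s|.  The paths of this tree are exactly the codes of winning
-- strategies of Player 2, and it has one because open games are determined
-- (Gale–Stewart): if Player 1 has no winning strategy, the strategy "stay
-- in positions from which Player 1 cannot force W" wins for Player 2.
--
-- From a tree we compute the open set of plays in
-- which Player 2's moves leave the tree.  Playing along a path defeats
-- every strategy of Player 1, and Player 2's replies, under a winning
-- strategy, to Player 1 always playing 0 form a path.

module Submission where

open import Defs
open import Level using (0ℓ)
open import Axiom.ExcludedMiddle using (ExcludedMiddle)
open import Data.Nat using (ℕ; zero; suc; _+_; _*_; _∸_; _≤_; _<_; z≤n; s≤s; pred; _<ᵇ_; _≡ᵇ_; _⊓_; _<?_)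
open import Data.Nat.Properties
open import Data.Fin using (Fin; punchIn) renaming (zero to fz; suc to fs)
open import Data.Vec using (Vec; []; _∷_; lookup; tabulate; tail)
open import Data.Vec.Properties using (tabulate∘lookup)
open import Data.List using (List; []; _∷_; applyUpTo; length; _++_; _∷ʳ_; drop)
open import Data.List.Properties using (applyUpTo-∷ʳ; length-applyUpTo; length-++; ≡-dec)
open import Data.Bool using (Bool; true; false; if_then_else_; _∧_; _∨_; not; T)
open import Data.Bool.Properties using (T-∧; T-∨; T-≡; ¬-not)
open import Data.Unit using (tt)
open import Data.Product using (Σ; _×_; _,_; proj₁; proj₂)
open import Data.Sum using (_⊎_; inj₁; inj₂)
open import Data.Empty using (⊥-elim)
open import Function.Bundles using (Equivalence)
open import Relation.Nullary using (¬_; Dec; yes; no; does)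
open import Relation.Nullary.Decidable using (dec-true; dec-false)
open import Relation.Binary.PropositionalEquality
open ≡-Reasoning
open import Relation.Binary using (tri<; tri≈; tri>)

Fun : ℕ → Set
Fun n = Baire → Vec ℕ n → ℕ

Impl : (n : ℕ) → Fun n → Set
Impl n F = Σ (PR n) λ t → ∀ α xs → α ⊢ t [ xs ]⇓ F α xs

Impls : (n m : ℕ) → (Baire → Vec ℕ n → Vec ℕ m) → Set
Impls n m G = Σ (Vec (PR n) m) λ ts → ∀ α xs → EvalAll α ts xs (G α xs)

impl-cong : ∀ {n} {F G : Fun n} → Impl n F → (∀ α xs → F α xs ≡ G α xs) → Impl n G
impl-cong (t , e) eq = t , λ α xs → subst (α ⊢ t [ xs ]⇓_) (eq α xs) (e α xs)

inil : ∀ {n} → Impls n 0 (λ _ _ → [])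
inil = [] , λ _ _ → []

icons : ∀ {n m F G} → Impl n F → Impls n m G → Impls n (suc m) (λ α xs → F α xs ∷ G α xs)
icons (t , e) (ts , es) = (t ∷ ts) , λ α xs → e α xs ∷ es α xs

icomp : ∀ {n m F G} → Impl m F → Impls n m G → Impl n (λ α xs → F α (G α xs))
icomp {G = G} (f , e) (gs , es) = comp f gs , λ α xs → e-comp (es α xs) (e α (G α xs))

iprec : ∀ {n} {F : Fun n} {G : Fun (suc (suc n))} (H : Fun (suc n)) →
        Impl n F → Impl (suc (suc n)) G →
        (∀ α xs → H α (zero ∷ xs) ≡ F α xs) →
        (∀ α k xs → H α (suc k ∷ xs) ≡ G α (k ∷ H α (k ∷ xs) ∷ xs)) → Impl (suc n) H
iprec {n} {F} {G} H (f , ef) (g , eg) h0 hS = prec f g , run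
  where
  run : ∀ α xs → α ⊢ prec f g [ xs ]⇓ H α xs
  run α (zero ∷ xs)  = subst (α ⊢ prec f g [ zero ∷ xs ]⇓_) (sym (h0 α xs)) (e-prec0 (ef α xs))
  run α (suc k ∷ xs) = subst (α ⊢ prec f g [ suc k ∷ xs ]⇓_) (sym (hS α k xs))
                         (e-precS (run α (k ∷ xs)) (eg α (k ∷ H α (k ∷ xs) ∷ xs)))

arg₀ : ∀ {n} → Vec ℕ (suc n) → ℕ
arg₀ xs = lookup xs fz

arg₁ : ∀ {n} → Vec ℕ (suc (suc n)) → ℕ
arg₁ xs = lookup xs (fs fz)

arg₂ : ∀ {n} → Vec ℕ (suc (suc (suc n))) → ℕ
arg₂ xs = lookup xs (fs (fs fz))

izer : ∀ {n} → Impl n (λ _ _ → 0)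
izer = zer , λ _ _ → e-zer

iproj : ∀ {n} (i : Fin n) → Impl n (λ _ xs → lookup xs i)
iproj i = proj i , λ _ _ → e-proj

v0 : ∀ {n} → Impl (suc n) (λ _ → arg₀)
v0 = iproj fz

v1 : ∀ {n} → Impl (suc (suc n)) (λ _ → arg₁)
v1 = iproj (fs fz)

v2 : ∀ {n} → Impl (suc (suc (suc n))) (λ _ → arg₂)
v2 = iproj (fs (fs fz))

isc : Impl 1 (λ _ xs → suc (arg₀ xs))
isc = sc , λ { _ (x ∷ []) → e-sc }

iorc : Impl 1 (λ α xs → α (arg₀ xs))
iorc = orc , λ { _ (x ∷ []) → e-orc }

iselect : ∀ {n m} (f : Fin m → Fin n) → Impls n m (λ _ v → tabulate (λ i → lookup v (f i)))
iselect {m = zero}  f = inil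
iselect {m = suc m} f = icons (iproj (f fz)) (iselect (λ i → f (fs i)))

ap1 : ∀ {n F G} → Impl 1 F → Impl n G → Impl n (λ α xs → F α (G α xs ∷ []))
ap1 f g = icomp f (icons g inil)

ap2 : ∀ {n F G H} → Impl 2 F → Impl n G → Impl n H → Impl n (λ α xs → F α (G α xs ∷ H α xs ∷ []))
ap2 f g h = icomp f (icons g (icons h inil))

ap3 : ∀ {n F G H K} → Impl 3 F → Impl n G → Impl n H → Impl n K →
      Impl n (λ α xs → F α (G α xs ∷ H α xs ∷ K α xs ∷ []))
ap3 f g h k = icomp f (icons g (icons h (icons k inil)))

iconst : ∀ {n} k → Impl n (λ _ _ → k)
iconst zero    = izer
iconst (suc k) = ap1 isc (iconst k)

-- Arithmetic, and Boolean tests with true and false represented by 1 and 0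
-- (Defs.char).

iadd : Impl 2 (λ _ xs → arg₀ xs + arg₁ xs)
iadd = iprec _ v0 (ap1 isc v1) (λ { _ (b ∷ []) → refl }) (λ { _ k (b ∷ []) → refl })

ipred : Impl 1 (λ _ xs → pred (arg₀ xs))
ipred = iprec _ izer v0 (λ { _ [] → refl }) (λ { _ k [] → refl })

imonus : Impl 2 (λ _ xs → arg₀ xs ∸ arg₁ xs)
imonus = ap2 flipped v1 v0
  where
  flipped : Impl 2 (λ _ xs → arg₁ xs ∸ arg₀ xs)
  flipped = iprec _ v0 (ap1 ipred v1) (λ { _ (a ∷ []) → refl })
              (λ { _ k (a ∷ []) → sym (pred[m∸n]≡m∸[1+n] a k) })

isZero : ℕ → ℕ
isZero zero    = 1
isZero (suc _) = 0

iisZero : Impl 1 (λ _ xs → isZero (arg₀ xs))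
iisZero = iprec _ (iconst 1) izer (λ { _ [] → refl }) (λ { _ k [] → refl })

ite : ℕ → ℕ → ℕ → ℕ
ite zero    a b = b
ite (suc _) a b = a

iite : Impl 3 (λ _ xs → ite (arg₀ xs) (arg₁ xs) (arg₂ xs))
iite = iprec _ v1 v2 (λ { _ (a ∷ b ∷ []) → refl }) (λ { _ k (a ∷ b ∷ []) → refl })

ite-char : ∀ b x y → ite (char b) x y ≡ (if b then x else y)
ite-char true  x y = refl
ite-char false x y = refl

ite-∧ : ∀ a b → ite (char a) (char b) 0 ≡ char (a ∧ b)
ite-∧ true  b = refl
ite-∧ false b = refl

ite-∨ : ∀ a b → ite (char a) 1 (char b) ≡ char (a ∨ b)
ite-∨ true  b = refl
ite-∨ false b = refl

ilt : Impl 2 (λ _ xs → char (arg₀ xs <ᵇ arg₁ xs))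
ilt = impl-cong (ap1 iisZero (ap2 imonus (ap1 isc v0) v1)) (λ { _ (a ∷ b ∷ []) → lt a b })
  where
  lt : ∀ a b → isZero (suc a ∸ b) ≡ char (a <ᵇ b)
  lt zero    zero    = refl
  lt zero    (suc b) = cong isZero (0∸n≡0 b)
  lt (suc a) zero    = refl
  lt (suc a) (suc b) = lt a b

ieq : Impl 2 (λ _ xs → char (arg₀ xs ≡ᵇ arg₁ xs))
ieq = impl-cong (ap1 iisZero (ap2 iadd (ap2 imonus v0 v1) (ap2 imonus v1 v0))) (λ { _ (a ∷ b ∷ []) → eq a b })
  where
  eq : ∀ a b → isZero ((a ∸ b) + (b ∸ a)) ≡ char (a ≡ᵇ b)
  eq zero    zero    = refl
  eq zero    (suc b) = refl
  eq (suc a) zero    = refl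
  eq (suc a) (suc b) = eq a b

iand : ∀ {n} {P Q : Baire → Vec ℕ n → Bool} →
       Impl n (λ α xs → char (P α xs)) → Impl n (λ α xs → char (Q α xs)) →
       Impl n (λ α xs → char (P α xs ∧ Q α xs))
iand {P = P} {Q} p q = impl-cong (ap3 iite p q izer) (λ α xs → ite-∧ (P α xs) (Q α xs))

ior : ∀ {n} {P Q : Baire → Vec ℕ n → Bool} →
      Impl n (λ α xs → char (P α xs)) → Impl n (λ α xs → char (Q α xs)) →
      Impl n (λ α xs → char (P α xs ∨ Q α xs))
ior {P = P} {Q} p q = impl-cong (ap3 iite p (iconst 1) q) (λ α xs → ite-∨ (P α xs) (Q α xs))

inot : ∀ {n} {P : Baire → Vec ℕ n → Bool} →
       Impl n (λ α xs → char (P α xs)) → Impl n (λ α xs → char (not (P α xs)))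
inot {P = P} p = impl-cong (ap1 iisZero p) (λ α xs → negate (P α xs))
  where
  negate : ∀ a → isZero (char a) ≡ char (not a)
  negate true  = refl
  negate false = refl

anyUpTo : ℕ → (ℕ → Bool) → Bool
anyUpTo zero    P = false
anyUpTo (suc k) P = anyUpTo k P ∨ P k

allUpTo : ℕ → (ℕ → Bool) → Bool
allUpTo zero    P = true
allUpTo (suc k) P = allUpTo k P ∧ P k

∧-elim : ∀ a {b} → T (a ∧ b) → T a × T b
∧-elim a = Equivalence.to (T-∧ {a})

∧-intro : ∀ a {b} → T a → T b → T (a ∧ b)
∧-intro a ta tb = Equivalence.from (T-∧ {a}) (ta , tb)

∨-elim : ∀ a {b} → T (a ∨ b) → T a ⊎ T b
∨-elim a = Equivalence.to (T-∨ {a})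

∨-introˡ : ∀ a {b} → T a → T (a ∨ b)
∨-introˡ a ta = Equivalence.from (T-∨ {a}) (inj₁ ta)

∨-introʳ : ∀ a {b} → T b → T (a ∨ b)
∨-introʳ a tb = Equivalence.from (T-∨ {a}) (inj₂ tb)

T⇒≡ : ∀ {b} → T b → b ≡ true
T⇒≡ = Equivalence.to T-≡

¬T⇒≡ : ∀ {b} → ¬ T b → b ≡ false
¬T⇒≡ ¬Tb = ¬-not (λ b≡true → ¬Tb (Equivalence.from T-≡ b≡true))

not≡true⇒¬T : ∀ {b} → not b ≡ true → ¬ T b
not≡true⇒¬T {true} () _

¬T⇒not≡true : ∀ {b} → ¬ T b → not b ≡ true
¬T⇒not≡true ¬Tb = cong not (¬T⇒≡ ¬Tb)

any-elim : ∀ N P → T (anyUpTo N P) → Σ ℕ λ k → k < N × T (P k)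
any-elim (suc N) P h with ∨-elim (anyUpTo N P) h
... | inj₁ h' = let (k , k<N , Pk) = any-elim N P h' in k , m≤n⇒m≤1+n k<N , Pk
... | inj₂ PN = N , ≤-refl , PN

any-intro : ∀ N P k → k < N → T (P k) → T (anyUpTo N P)
any-intro (suc N) P k k<1+N Pk with m≤n⇒m<n∨m≡n (≤-pred k<1+N)
... | inj₁ k<N = ∨-introˡ (anyUpTo N P) (any-intro N P k k<N Pk)
... | inj₂ refl = ∨-introʳ (anyUpTo k P) Pk

all-elim : ∀ N P → T (allUpTo N P) → ∀ k → k < N → T (P k)
all-elim (suc N) P h k k<1+N with m≤n⇒m<n∨m≡n (≤-pred k<1+N)
... | inj₁ k<N = all-elim N P (proj₁ (∧-elim (allUpTo N P) h)) k k<N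
... | inj₂ refl = proj₂ (∧-elim (allUpTo k P) h)

all-intro : ∀ N P → (∀ k → k < N → T (P k)) → T (allUpTo N P)
all-intro zero    P h = tt
all-intro (suc N) P h =
  ∧-intro (allUpTo N P) (all-intro N P (λ k k<N → h k (m≤n⇒m≤1+n k<N))) (h N ≤-refl)

-- The step of a bounded recursion sees k ∷ r ∷ xs; its body only needs k ∷ xs.
iskipRec : ∀ {n} {F : Fun (suc n)} → Impl (suc n) F →
           Impl (suc (suc n)) (λ α v → F α (arg₀ v ∷ tail (tail v)))
iskipRec {F = F} f = impl-cong (icomp f (iselect (punchIn (fs fz))))
  (λ { α (k ∷ r ∷ xs) → cong (λ v → F α (k ∷ v)) (tabulate∘lookup xs) })

iany : ∀ {n} {P : Baire → Vec ℕ (suc n) → Bool} → Impl (suc n) (λ α xs → char (P α xs)) →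
       Impl (suc n) (λ α xs → char (anyUpTo (arg₀ xs) (λ k → P α (k ∷ tail xs))))
iany {P = P} p = iprec _ izer (ap3 iite v1 (iconst 1) (iskipRec p)) (λ _ _ → refl)
  (λ α k xs → sym (ite-∨ (anyUpTo k (λ j → P α (j ∷ xs))) (P α (k ∷ xs))))

iall : ∀ {n} {P : Baire → Vec ℕ (suc n) → Bool} → Impl (suc n) (λ α xs → char (P α xs)) →
       Impl (suc n) (λ α xs → char (allUpTo (arg₀ xs) (λ k → P α (k ∷ tail xs))))
iall {P = P} p = iprec _ (iconst 1) (ap3 iite v1 (iskipRec p) izer) (λ _ _ → refl)
  (λ α k xs → sym (ite-∧ (allUpTo k (λ j → P α (j ∷ xs))) (P α (k ∷ xs))))

-- Cantor pairing is inverted by locating the diagonal of c: the unique d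
-- with tri d ≤ c < tri (suc d).  diag computes it by counting up.

diag : ℕ → ℕ
diag zero    = 0
diag (suc c) = if tri (suc (diag c)) <ᵇ suc (suc c) then suc (diag c) else diag c

itri : Impl 1 (λ _ xs → tri (arg₀ xs))
itri = iprec _ izer (ap2 iadd (ap1 isc v0) v1) (λ _ _ → refl) (λ { _ k [] → refl })

icantor : Impl 2 (λ _ xs → cantor (arg₀ xs) (arg₁ xs))
icantor = ap2 iadd (ap1 itri (ap2 iadd v0 v1)) v1

idiag : Impl 1 (λ _ xs → diag (arg₀ xs))
idiag = iprec _ izer (ap3 iite (ap2 ilt (ap1 itri (ap1 isc v1)) (ap1 isc (ap1 isc v0))) (ap1 isc v1) v1)
          (λ _ _ → refl) (λ { _ k [] → sym (ite-char (tri (suc (diag k)) <ᵇ suc (suc k)) _ _) })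

tri-mono : ∀ {m n} → m ≤ n → tri m ≤ tri n
tri-mono {zero}          _       = z≤n
tri-mono {suc m} {suc n} (s≤s h) = +-mono-≤ (s≤s h) (tri-mono h)

diag-spec : ∀ c → tri (diag c) ≤ c × c < tri (suc (diag c))
diag-spec zero = z≤n , s≤s z≤n
diag-spec (suc c) with diag-spec c | tri (suc (diag c)) <ᵇ suc (suc c) in eq
... | (lo , hi) | true  = ≤-pred (<ᵇ⇒< _ _ (subst T (sym eq) tt)) ,
                          ≤-<-trans hi (s≤s (m≤n+m (tri (suc (diag c))) (suc (diag c))))
... | (lo , hi) | false = m≤n⇒m≤1+n lo , ≮⇒≥ (λ lt → subst T eq (<⇒<ᵇ lt))

diag-unique : ∀ c d → tri d ≤ c → c < tri (suc d) → diag c ≡ d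
diag-unique c d lo hi with <-cmp (diag c) d
... | tri< lt _ _ = ⊥-elim (<⇒≱ (proj₂ (diag-spec c)) (≤-trans (tri-mono lt) lo))
... | tri≈ _ e _  = e
... | tri> _ _ gt = ⊥-elim (<⇒≱ hi (≤-trans (tri-mono gt) (proj₁ (diag-spec c))))

diag-cantor : ∀ a b → diag (cantor a b) ≡ a + b
diag-cantor a b = diag-unique (cantor a b) (a + b) (m≤m+n _ _)
  (subst (_< suc (a + b) + tri (a + b)) (+-comm b (tri (a + b))) (+-monoˡ-< (tri (a + b)) (s≤s (m≤n+m b a))))

unpair₂ : ℕ → ℕ
unpair₂ c = c ∸ tri (diag c)

unpair₁ : ℕ → ℕ
unpair₁ c = diag c ∸ unpair₂ c

unpair₂-cantor : ∀ a b → unpair₂ (cantor a b) ≡ b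
unpair₂-cantor a b = trans (cong (λ d → cantor a b ∸ tri d) (diag-cantor a b)) (m+n∸m≡n (tri (a + b)) b)

unpair₁-cantor : ∀ a b → unpair₁ (cantor a b) ≡ a
unpair₁-cantor a b = trans (cong₂ _∸_ (diag-cantor a b) (unpair₂-cantor a b)) (m+n∸n≡m a b)

hd : ℕ → ℕ
hd c = unpair₁ (pred c)

tl : ℕ → ℕ
tl c = unpair₂ (pred c)

tails : ℕ → ℕ → ℕ
tails zero    c = c
tails (suc i) c = tl (tails i c)

nth : ℕ → ℕ → ℕ
nth c i = hd (tails i c)

countTails : ℕ → ℕ → ℕ
countTails zero    c = 0
countTails (suc k) c = countTails k c + isZero (isZero (tails k c))

len : ℕ → ℕ
len c = countTails c c

ihd : Impl 1 (λ _ xs → hd (arg₀ xs))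
ihd = ap1 (ap2 imonus idiag iunpair₂) ipred
  where iunpair₂ : Impl 1 (λ _ xs → unpair₂ (arg₀ xs))
        iunpair₂ = ap2 imonus v0 (ap1 itri idiag)

itl : Impl 1 (λ _ xs → tl (arg₀ xs))
itl = ap1 (ap2 imonus v0 (ap1 itri idiag)) ipred

itails : Impl 2 (λ _ xs → tails (arg₀ xs) (arg₁ xs))
itails = iprec _ v0 (ap1 itl v1) (λ { _ (c ∷ []) → refl }) (λ { _ k (c ∷ []) → refl })

inth : Impl 2 (λ _ xs → nth (arg₀ xs) (arg₁ xs))
inth = ap1 ihd (ap2 itails v1 v0)

ilen : Impl 1 (λ _ xs → len (arg₀ xs))
ilen = ap2 icountTails v0 v0
  where
  icountTails : Impl 2 (λ _ xs → countTails (arg₀ xs) (arg₁ xs))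
  icountTails = iprec _ izer (ap2 iadd v1 (ap1 iisZero (ap1 iisZero (ap2 itails v0 v2))))
                  (λ { _ (c ∷ []) → refl }) (λ { _ k (c ∷ []) → refl })

head₀ : List ℕ → ℕ
head₀ []      = 0
head₀ (a ∷ _) = a

tail₀ : List ℕ → List ℕ
tail₀ []      = []
tail₀ (_ ∷ s) = s

at : List ℕ → ℕ → ℕ
at l i = head₀ (drop i l)

drop-[] : ∀ i → drop i ([] {A = ℕ}) ≡ []
drop-[] zero    = refl
drop-[] (suc i) = refl

drop-suc : ∀ i (l : List ℕ) → drop (suc i) l ≡ tail₀ (drop i l)
drop-suc zero    []      = refl
drop-suc (suc i) []      = refl
drop-suc zero    (a ∷ s) = refl
drop-suc (suc i) (a ∷ s) = drop-suc i s

tl-code : ∀ l → tl (code l) ≡ code (tail₀ l)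
tl-code []      = refl
tl-code (a ∷ s) = unpair₂-cantor a (code s)

hd-code : ∀ l → hd (code l) ≡ head₀ l
hd-code []      = refl
hd-code (a ∷ s) = unpair₁-cantor a (code s)

tails-code : ∀ i l → tails i (code l) ≡ code (drop i l)
tails-code zero    l = refl
tails-code (suc i) l = begin
  tl (tails i (code l))    ≡⟨ cong tl (tails-code i l) ⟩
  tl (code (drop i l))     ≡⟨ tl-code (drop i l) ⟩
  code (tail₀ (drop i l))  ≡⟨ cong code (drop-suc i l) ⟨
  code (drop (suc i) l)    ∎

nth-code : ∀ l i → nth (code l) i ≡ at l i
nth-code l i = trans (cong hd (tails-code i l)) (hd-code (drop i l))

nonempty-drop : ∀ l k → isZero (isZero (code (drop k l))) ≡ char (k <ᵇ length l)
nonempty-drop []      k       = cong (λ v → isZero (isZero (code v))) (drop-[] k)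
nonempty-drop (a ∷ s) zero    = refl
nonempty-drop (a ∷ s) (suc k) = nonempty-drop s k

countTails-code : ∀ k l → countTails k (code l) ≡ k ⊓ length l
countTails-code zero    l = refl
countTails-code (suc k) l = begin
  countTails k (code l) + isZero (isZero (tails k (code l)))
    ≡⟨ cong₂ _+_ (countTails-code k l) (trans (cong (λ c → isZero (isZero c)) (tails-code k l)) (nonempty-drop l k)) ⟩
  k ⊓ length l + char (k <ᵇ length l)
    ≡⟨ step k (length l) ⟩
  suc k ⊓ length l ∎
  where
  step : ∀ k n → k ⊓ n + char (k <ᵇ n) ≡ suc k ⊓ n
  step zero    zero    = refl
  step zero    (suc n) = refl
  step (suc k) zero    = refl
  step (suc k) (suc n) = cong suc (step k n)

length≤code : ∀ l → length l ≤ code l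
length≤code []      = z≤n
length≤code (a ∷ s) = s≤s (≤-trans (length≤code s) (m≤n+m (code s) (tri (a + code s))))

len-code : ∀ l → len (code l) ≡ length l
len-code l = trans (countTails-code (code l) l) (m≥n⇒m⊓n≡n (length≤code l))

applyUpTo-cong : ∀ {f g : ℕ → ℕ} n → (∀ i → i < n → f i ≡ g i) → applyUpTo f n ≡ applyUpTo g n
applyUpTo-cong zero    h = refl
applyUpTo-cong (suc n) h = cong₂ _∷_ (h 0 (s≤s z≤n)) (applyUpTo-cong n (λ i i<n → h (suc i) (s≤s i<n)))

at-applyUpTo : ∀ f L i → i < L → at (applyUpTo f L) i ≡ f i
at-applyUpTo f (suc L) zero    _       = refl
at-applyUpTo f (suc L) (suc i) (s≤s h) = at-applyUpTo (λ j → f (suc j)) L i h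

applyUpTo-at : ∀ l → applyUpTo (at l) (length l) ≡ l
applyUpTo-at []      = refl
applyUpTo-at (a ∷ s) = cong (a ∷_) (applyUpTo-at s)

at-++ : ∀ s t i → i < length s → at (s ++ t) i ≡ at s i
at-++ (a ∷ s) t zero    _       = refl
at-++ (a ∷ s) t (suc i) (s≤s lt) = at-++ s t i lt

len-applyUpTo : ∀ (f : ℕ → ℕ) n → len (code (applyUpTo f n)) ≡ n
len-applyUpTo f n = trans (len-code (applyUpTo f n)) (length-applyUpTo f n)

nth-applyUpTo : ∀ (f : ℕ → ℕ) n i → i < n → nth (code (applyUpTo f n)) i ≡ f i
nth-applyUpTo f n i lt = trans (nth-code (applyUpTo f n) i) (at-applyUpTo f n i lt)

listOf : ℕ → List ℕ
listOf n = applyUpTo (nth n) (len n)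

listOf-code : ∀ l → listOf (code l) ≡ l
listOf-code l = begin
  applyUpTo (nth (code l)) (len (code l))  ≡⟨ cong (applyUpTo (nth (code l))) (len-code l) ⟩
  applyUpTo (nth (code l)) (length l)      ≡⟨ applyUpTo-cong (length l) (λ i _ → nth-code l i) ⟩
  applyUpTo (at l) (length l)              ≡⟨ applyUpTo-at l ⟩
  l                                        ∎

code-mono : ∀ (f : ℕ → ℕ) {k L} → k ≤ L → code (applyUpTo f k) ≤ code (applyUpTo f L)
code-mono f {zero}          h       = z≤n
code-mono f {suc k} {suc L} (s≤s h) =
  s≤s (+-mono-≤ (tri-mono (+-monoʳ-≤ (f 0) rest)) rest)
  where rest = code-mono (λ j → f (suc j)) h

-- buildFrom F k m codes F (m ∸ k), …, F (m ∸ 1); a recursion on k that adds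
-- entries at the front.
buildFrom : (ℕ → ℕ) → ℕ → ℕ → ℕ
buildFrom F zero    m = 0
buildFrom F (suc k) m = suc (cantor (F (m ∸ suc k)) (buildFrom F k m))

buildFrom-code : ∀ F m k → k ≤ m → buildFrom F k m ≡ code (applyUpTo (λ i → F (m ∸ k + i)) k)
buildFrom-code F m zero    _     = refl
buildFrom-code F m (suc k) sk≤m =
  cong₂ (λ a b → suc (cantor a b)) (cong F (sym (+-identityʳ (m ∸ suc k))))
    (trans (buildFrom-code F m k (<⇒≤ sk≤m)) (cong code (applyUpTo-cong k (λ i _ → cong F (sym (shift i))))))
  where
  shift : ∀ i → m ∸ suc k + suc i ≡ m ∸ k + i
  shift i = trans (+-suc (m ∸ suc k) i) (cong (_+ i) (sym (+-∸-assoc 1 sk≤m)))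

buildFrom-all : ∀ F m → buildFrom F m m ≡ code (applyUpTo F m)
buildFrom-all F m = trans (buildFrom-code F m m ≤-refl)
  (cong code (applyUpTo-cong m (λ i _ → cong F (cong (_+ i) (n∸n≡0 m)))))

icode : ∀ {n} {F : Baire → Vec ℕ (suc n) → ℕ} → Impl (suc n) F →
        Impl (suc n) (λ α xs → code (applyUpTo (λ i → F α (i ∷ tail xs)) (arg₀ xs)))
icode {n} {F} p = impl-cong (icomp ibuild (icons v0 (icons v0 (iselect fs))))
  (λ { α (m ∷ ps) → trans (cong (λ v → buildFrom (λ i → F α (i ∷ v)) m m) (tabulate∘lookup ps))
                          (buildFrom-all (λ i → F α (i ∷ ps)) m) })
  where
  entryArgs : Impls (suc (suc (suc n))) (suc n) _
  entryArgs = icons (ap2 imonus v2 (ap1 isc v0)) (iselect (λ i → fs (fs (fs i))))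
  ibuild : Impl (suc (suc n)) (λ α xs → buildFrom (λ i → F α (i ∷ tail (tail xs))) (arg₀ xs) (arg₁ xs))
  ibuild = iprec _ izer (ap1 isc (ap2 icantor (icomp p entryArgs) v1)) (λ _ _ → refl)
    (λ { α k (m ∷ ps) → cong (λ v → suc (cantor (F α ((m ∸ suc k) ∷ v)) (buildFrom (λ i → F α (i ∷ ps)) k m)))
                             (sym (tabulate∘lookup ps)) })

prefix : ℕ → ℕ → ℕ
prefix j k = code (applyUpTo (nth j) k)

iprefix : Impl 2 (λ _ xs → prefix (arg₀ xs) (arg₁ xs))
iprefix = ap2 (icode (ap2 inth v1 v0)) v1 v0

snoc : ℕ → ℕ → ℕ
snoc c a = code (applyUpTo (λ i → ite (char (i <ᵇ len c)) (nth c i) a) (suc (len c)))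

isnoc : Impl 2 (λ _ xs → snoc (arg₀ xs) (arg₁ xs))
isnoc = ap3 (icode (ap3 iite (ap2 ilt v0 (ap1 ilen v1)) (ap2 inth v1 v0) v2)) (ap1 isc (ap1 ilen v0)) v0 v1

snoc-code : ∀ u a → snoc (code u) a ≡ code (u ∷ʳ a)
snoc-code u a = begin
  code (applyUpTo (λ i → ite (char (i <ᵇ len (code u))) (nth (code u) i) a) (suc (len (code u))))
    ≡⟨ cong (λ L → code (applyUpTo (λ i → ite (char (i <ᵇ len (code u))) (nth (code u) i) a) (suc L))) (len-code u) ⟩
  code (applyUpTo (λ i → ite (char (i <ᵇ len (code u))) (nth (code u) i) a) (suc (length u)))
    ≡⟨ cong code (applyUpTo-cong (suc (length u)) (λ i _ →
         cong₂ (λ b v → ite (char b) v a) (cong (i <ᵇ_) (len-code u)) (nth-code u i))) ⟩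
  code (applyUpTo (λ i → ite (char (i <ᵇ length u)) (at u i) a) (suc (length u)))
    ≡⟨ cong code (entries u) ⟩
  code (u ∷ʳ a) ∎
  where
  entries : ∀ u → applyUpTo (λ i → ite (char (i <ᵇ length u)) (at u i) a) (suc (length u)) ≡ u ∷ʳ a
  entries []      = refl
  entries (b ∷ u) = cong (b ∷_) (entries u)

interleave-odd : ∀ (p q : Baire) n → ⟨ p , q ⟩ (suc (2 * n)) ≡ q n
interleave-odd p q zero    = refl
interleave-odd p q (suc n) =
  trans (cong (λ k → ⟨ p , q ⟩ (suc k)) (*-suc 2 n)) (interleave-odd (λ i → p (suc i)) (λ i → q (suc i)) n)

iodd-index : Impl 1 (λ _ xs → suc (2 * arg₀ xs))
iodd-index = impl-cong (ap1 isc (ap2 iadd v0 v0)) (λ { _ (n ∷ []) → cong suc (cong (n +_) (sym (+-identityʳ n))) })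

iodd : Impl 1 (λ α xs → α (suc (2 * arg₀ xs)))
iodd = ap1 iorc iodd-index

parity : ∀ n → (Σ ℕ λ a → n ≡ 2 * a) ⊎ (Σ ℕ λ a → n ≡ suc (2 * a))
parity zero = inj₁ (0 , refl)
parity (suc n) with parity n
... | inj₁ (a , e) = inj₂ (a , cong suc e)
... | inj₂ (a , e) = inj₁ (suc a , trans (cong suc e) (sym (*-suc 2 a)))

par : ℕ → ℕ
par zero    = 0
par (suc k) = isZero (par k)

half : ℕ → ℕ
half zero    = 0
half (suc k) = half k + par k

ipar : Impl 1 (λ _ xs → par (arg₀ xs))
ipar = iprec _ izer (ap1 iisZero v1) (λ _ _ → refl) (λ { _ k [] → refl })

ihalf : Impl 1 (λ _ xs → half (arg₀ xs))
ihalf = iprec _ izer (ap2 iadd v1 (ap1 ipar v0)) (λ _ _ → refl) (λ { _ k [] → refl })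

par-even : ∀ a → par (2 * a) ≡ 0
par-odd  : ∀ a → par (suc (2 * a)) ≡ 1
par-even zero    = refl
par-even (suc a) = trans (cong par (*-suc 2 a)) (cong isZero (par-odd a))
par-odd a = cong isZero (par-even a)

half-even : ∀ a → half (2 * a) ≡ a
half-odd  : ∀ a → half (suc (2 * a)) ≡ a
half-even zero    = refl
half-even (suc a) = trans (cong half (*-suc 2 a)) (trans (cong₂ _+_ (half-odd a) (par-odd a)) (+-comm a 1))
half-odd a = trans (cong₂ _+_ (half-even a) (par-even a)) (+-identityʳ a)

half-bound : ∀ m L → m < half L → suc (2 * m) < L
half-bound m L lt with parity L
... | inj₁ (a , refl) = subst (_≤ 2 * a) (*-suc 2 m) (*-monoʳ-≤ 2 (subst (m <_) (half-even a) lt))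
... | inj₂ (a , refl) = s≤s (<⇒≤ (subst (_≤ 2 * a) (*-suc 2 m) (*-monoʳ-≤ 2 (subst (m <_) (half-odd a) lt))))

evenOdd : (ℕ → ℕ) → (ℕ → ℕ) → Baire
evenOdd p r n = if par n ≡ᵇ 0 then p n else r (half n)

evenOdd-even : ∀ p r a → evenOdd p r (2 * a) ≡ p (2 * a)
evenOdd-even p r a = cong (λ b → if b ≡ᵇ 0 then p (2 * a) else r (half (2 * a))) (par-even a)

evenOdd-odd : ∀ p r a → evenOdd p r (suc (2 * a)) ≡ r a
evenOdd-odd p r a = trans (cong (λ b → if b ≡ᵇ 0 then p (suc (2 * a)) else r (half (suc (2 * a)))) (par-odd a))
                          (cong r (half-odd a))

length-snoc : ∀ (s : List ℕ) m → length (s ∷ʳ m) ≡ suc (length s)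
length-snoc s m = trans (length-++ s) (+-comm (length s) 1)

↾-suc : ∀ (x : Baire) n → x ↾ suc n ≡ (x ↾ n) ∷ʳ x n
↾-suc x n = sym (applyUpTo-∷ʳ x n)

≺-↾ : ∀ (x : Baire) n → (x ↾ n) ≺ x
≺-↾ x n = cong (x ↾_) (sym (length-applyUpTo x n))

≺-snoc : ∀ {s x m} → s ≺ x → x (length s) ≡ m → (s ∷ʳ m) ≺ x
≺-snoc {s} {x} {m} h e = begin
  s ∷ʳ m                          ≡⟨ cong₂ _∷ʳ_ h (sym e) ⟩
  (x ↾ length s) ∷ʳ x (length s)  ≡⟨ applyUpTo-∷ʳ x (length s) ⟩
  x ↾ suc (length s)              ≡⟨ cong (x ↾_) (length-snoc s m) ⟨
  x ↾ length (s ∷ʳ m)             ∎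

≺-at : ∀ {s x} i → s ≺ x → i < length s → at s i ≡ x i
≺-at {s} {x} i h lt = trans (cong (λ u → at u i) h) (at-applyUpTo x (length s) i lt)

position : (ℕ → List ℕ → ℕ) → ℕ → List ℕ
position mv zero    = []
position mv (suc n) = position mv n ∷ʳ mv n (position mv n)

play : (ℕ → List ℕ → ℕ) → Baire
play mv n = mv n (position mv n)

position-play : ∀ mv n → position mv n ≡ play mv ↾ n
position-play mv zero    = refl
position-play mv (suc n) =
  trans (cong (_∷ʳ mv n (position mv n)) (position-play mv n)) (applyUpTo-∷ʳ (play mv) n)

-- Open determinacy (Gale–Stewart); the only use of excluded middle.

IsOpen : (Baire → Set) → Set
IsOpen W = ∀ x → W x → Σ (List ℕ) λ w → w ≺ x × (∀ x' → w ≺ x' → W x')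

named-isOpen : ∀ {p W} → Names OpenSp p W → IsOpen W
named-isOpen names x wx with proj₁ (names x) wx
... | (i , w , e , w≺x) = w , w≺x , λ x' w≺x' → proj₂ (names x') (i , w , e , w≺x')

witness : ∀ {P : ℕ → Set} → Dec (Σ ℕ P) → ℕ
witness (yes (m , _)) = m
witness (no _)        = 0

witness-ok : ∀ {P : ℕ → Set} (d : Dec (Σ ℕ P)) → Σ ℕ P → P (witness d)
witness-ok (yes (m , Pm)) _ = Pm
witness-ok (no ¬∃)        ∃ = ⊥-elim (¬∃ ∃)

module OpenDeterminacy (em : ExcludedMiddle 0ℓ) (W : Baire → Set) where

  Forces : List ℕ → Set
  Forces s = Σ Strategy λ σ →
    ∀ x → s ≺ x → (∀ n → length s ≤ 2 * n → x (2 * n) ≡ σ (x ↾ (2 * n))) → W x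

  Safe : List ℕ → Set
  Safe s = ¬ Forces s

  -- At a position where Player 1 moves, safety is kept by every move:
  -- otherwise Player 1 would force W by playing m and continuing with τ.
  safe-P1-move : ∀ s a → length s ≡ 2 * a → Safe s → ∀ m → Safe (s ∷ʳ m)
  safe-P1-move s a len≡ safe m (τ , τ-forces) = safe (σ , σ-forces)
    where
    σ : Strategy
    σ u = if does (≡-dec _≟_ u s) then m else τ u
    σ-forces : ∀ x → s ≺ x → (∀ n → length s ≤ 2 * n → x (2 * n) ≡ σ (x ↾ (2 * n))) → W x
    σ-forces x s≺x follows = τ-forces x (≺-snoc s≺x x|s|≡m) follows-τ
      where
      x|s|≡m : x (length s) ≡ m
      x|s|≡m = begin
        x (length s)        ≡⟨ cong x len≡ ⟩
        x (2 * a)           ≡⟨ follows a (≤-reflexive len≡) ⟩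
        σ (x ↾ (2 * a))     ≡⟨ cong σ (trans (cong (x ↾_) (sym len≡)) (sym s≺x)) ⟩
        σ s                 ≡⟨ cong (if_then m else τ s) (dec-true (≡-dec _≟_ s s) refl) ⟩
        m                   ∎
      follows-τ : ∀ n → length (s ∷ʳ m) ≤ 2 * n → x (2 * n) ≡ τ (x ↾ (2 * n))
      follows-τ n le = trans (follows n (<⇒≤ later))
                         (cong (if_then m else τ (x ↾ (2 * n))) (dec-false (≡-dec _≟_ (x ↾ (2 * n)) s) different))
        where
        later : length s < 2 * n
        later = subst (_≤ 2 * n) (length-snoc s m) le
        different : ¬ (x ↾ (2 * n) ≡ s)
        different e = <-irrefl (trans (sym (cong length e)) (length-applyUpTo x (2 * n))) later

  -- At a position where Player 2 moves, some move keeps safety: otherwise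
  -- Player 1 forces W after every move m, and these strategies combine.
  safe-P2-move : ∀ s → Safe s → Σ ℕ λ m → Safe (s ∷ʳ m)
  safe-P2-move s safe with em {Σ ℕ λ m → Safe (s ∷ʳ m)}
  ... | yes ∃safe = ∃safe
  ... | no ∄safe  = ⊥-elim (safe (σ , σ-forces))
    where
    forces : ∀ m → Forces (s ∷ʳ m)
    forces m with em {Forces (s ∷ʳ m)}
    ... | yes f = f
    ... | no ¬f = ⊥-elim (∄safe (m , ¬f))
    σ : Strategy
    σ u = proj₁ (forces (at u (length s))) u
    σ-forces : ∀ x → s ≺ x → (∀ n → length s ≤ 2 * n → x (2 * n) ≡ σ (x ↾ (2 * n))) → W x
    σ-forces x s≺x follows = proj₂ (forces (x (length s))) x (≺-snoc s≺x refl) follows-m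
      where
      follows-m : ∀ n → length (s ∷ʳ x (length s)) ≤ 2 * n →
                  x (2 * n) ≡ proj₁ (forces (x (length s))) (x ↾ (2 * n))
      follows-m n le = trans (follows n (<⇒≤ later))
          (cong (λ k → proj₁ (forces k) (x ↾ (2 * n))) (at-applyUpTo x (2 * n) (length s) later))
        where
        later : length s < 2 * n
        later = subst (_≤ 2 * n) (length-snoc s (x (length s))) le

  σsafe : Strategy
  σsafe u = witness (em {Σ ℕ λ m → Safe (u ∷ʳ m)})

  σsafe-safe : ∀ u → Safe u → Safe (u ∷ʳ σsafe u)
  σsafe-safe u safe = witness-ok (em {Σ ℕ λ m → Safe (u ∷ʳ m)}) (safe-P2-move u safe)

  safe-along : ¬ (Σ Strategy λ σ → P1Winning W σ) → (τ : Strategy) → (∀ u → τ u ≡ σsafe u) →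
               ∀ x → P2Consistent τ x → ∀ n → Safe (x ↾ n)
  safe-along noP1 τ τ≗σ x follows zero (σ , σ-forces) =
    noP1 (σ , λ x' follows' → σ-forces x' refl (λ n _ → follows' n))
  safe-along noP1 τ τ≗σ x follows (suc n) = subst Safe (sym (↾-suc x n)) (step (parity n))
    where
    safe-n : Safe (x ↾ n)
    safe-n = safe-along noP1 τ τ≗σ x follows n
    step : ((Σ ℕ λ a → n ≡ 2 * a) ⊎ (Σ ℕ λ a → n ≡ suc (2 * a))) → Safe ((x ↾ n) ∷ʳ x n)
    step (inj₁ (a , n≡2a))  = safe-P1-move (x ↾ n) a (trans (length-applyUpTo x n) n≡2a) safe-n (x n)
    step (inj₂ (a , n≡2a+1)) = subst (λ m → Safe ((x ↾ n) ∷ʳ m)) (sym x-reply) (σsafe-safe (x ↾ n) safe-n)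
      where
      x-reply : x n ≡ σsafe (x ↾ n)
      x-reply = begin
        x n                        ≡⟨ cong x n≡2a+1 ⟩
        x (suc (2 * a))            ≡⟨ follows a ⟩
        τ (x ↾ suc (2 * a))        ≡⟨ cong (λ k → τ (x ↾ k)) n≡2a+1 ⟨
        τ (x ↾ n)                  ≡⟨ τ≗σ (x ↾ n) ⟩
        σsafe (x ↾ n)              ∎

  -- A play in an open W passes through a string all of whose extensions
  -- lie in W, an unsafe position; so σsafe wins for Player 2.
  σsafe-wins : IsOpen W → ¬ (Σ Strategy λ σ → P1Winning W σ) →
               (τ : Strategy) → (∀ u → τ u ≡ σsafe u) → P2Winning W τ
  σsafe-wins open-W noP1 τ τ≗σ x follows wx with open-W x wx
  ... | (w , w≺x , w⊆W) =
    subst Safe (sym w≺x) (safe-along noP1 τ τ≗σ x follows (length w)) ((λ _ → 0) , λ x' w≺x' _ → w⊆W x' w≺x')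

≤W-intro : ∀ {a b c d} {X : RepSpace a} {Y : RepSpace b} {Z : RepSpace c} {V : RepSpace d}
           {f : MVF X Y} {g : MVF Z V} (H K : Baire → Baire) →
           Impl 1 (λ α xs → H α (arg₀ xs)) → Impl 1 (λ α xs → K α (arg₀ xs)) →
           (∀ x → dom f x → ∀ p → Names X p x →
              Σ (Carrier Z) λ z → dom g z × Names Z (H p) z ×
                (∀ v r → rel g z v → Names V r v →
                   Σ (Carrier Y) λ y → rel f x y × Names Y (K ⟨ p , r ⟩) y)) →
           f ≤W g
≤W-intro H K (h , h-ok) (k , k-ok) transfer = h , k , λ DomG G G-realizes x fx p px →
  let (z , gz , Hp-names-z , back) = transfer x fx p px
      (dq , v , gzv , r-names-v)   = G-realizes z gz (H p) Hp-names-z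
      (y , fxy , names-y)          = back v (G (H p) dq) gzv r-names-v
  in H p , (λ n → h-ok p (n ∷ [])) , dq , K ⟨ p , G (H p) dq ⟩ ,
     (λ n → k-ok ⟨ p , G (H p) dq ⟩ (n ∷ [])) , y , fxy , names-y

encodeStrat : Strategy → Baire
encodeStrat σ n = σ (listOf n)

decode-encode : ∀ σ u → decodeStrat (encodeStrat σ) u ≡ σ u
decode-encode σ u = cong σ (listOf-code u)

-- A strategy prefix is a code c of y 0, …, y (len c ∸ 1).  The position
-- coded by j conforms to c if each of its moves k by Player 2 is the entry
-- of c at the code of the position before move k.
ConformsAt : ℕ → ℕ → ℕ → Bool
ConformsAt k j c = (par k ≡ᵇ 0) ∨ ((nth j k ≡ᵇ nth c (prefix j k)) ∧ (prefix j k <ᵇ len c))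

Conforms : ℕ → ℕ → Bool
Conforms j c = allUpTo (len j) (λ k → ConformsAt k j c)

AgreesAt : ℕ → ℕ → ℕ → Set
AgreesAt j c k = prefix j k < len c × nth j k ≡ nth c (prefix j k)

conforms-elim : ∀ j c → T (Conforms j c) → ∀ a → suc (2 * a) < len j → AgreesAt j c (suc (2 * a))
conforms-elim j c h a k<len
  with ∨-elim (par (suc (2 * a)) ≡ᵇ 0) (all-elim (len j) (λ k → ConformsAt k j c) h (suc (2 * a)) k<len)
... | inj₁ even  = ⊥-elim (1+n≢0 (trans (sym (par-odd a)) (≡ᵇ⇒≡ _ 0 even)))
... | inj₂ agree = let (eq , lt) = ∧-elim (nth j (suc (2 * a)) ≡ᵇ nth c (prefix j (suc (2 * a)))) agree
                   in <ᵇ⇒< _ _ lt , ≡ᵇ⇒≡ _ _ eq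

conforms-intro : ∀ j c → (∀ a → suc (2 * a) < len j → AgreesAt j c (suc (2 * a))) → T (Conforms j c)
conforms-intro j c agrees = all-intro (len j) (λ k → ConformsAt k j c) at-k
  where
  at-k : ∀ k → k < len j → T (ConformsAt k j c)
  at-k k k<len with parity k
  ... | inj₁ (a , refl) = ∨-introˡ (par (2 * a) ≡ᵇ 0) (≡⇒≡ᵇ _ 0 (par-even a))
  ... | inj₂ (a , refl) = let (lt , eq) = agrees a k<len in
    ∨-introʳ (par (suc (2 * a)) ≡ᵇ 0) (∧-intro (nth j k ≡ᵇ nth c (prefix j k)) (≡⇒≡ᵇ _ _ eq) (<⇒<ᵇ lt))

prefix-↾ : ∀ (x : Baire) L k → k ≤ L → prefix (code (x ↾ L)) k ≡ code (x ↾ k)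
prefix-↾ x L k k≤L = cong code (applyUpTo-cong k (λ i i<k → nth-applyUpTo x L i (<-≤-trans i<k k≤L)))

consistent-conforms : ∀ y x → P2Consistent (decodeStrat y) x →
                      ∀ L n → code (x ↾ L) < n → T (Conforms (code (x ↾ L)) (code (y ↾ n)))
consistent-conforms y x consistent L n j<n = conforms-intro j C agrees
  where
  j : ℕ
  j = code (x ↾ L)
  C : ℕ
  C = code (y ↾ n)
  agrees : ∀ a → suc (2 * a) < len j → AgreesAt j C (suc (2 * a))
  agrees a k<len = subst (_< len C) (sym prefix≡) bound , nth≡
    where
    k : ℕ
    k = suc (2 * a)
    k<L : k < L
    k<L = subst (k <_) (len-applyUpTo x L) k<len
    prefix≡ : prefix j k ≡ code (x ↾ k)
    prefix≡ = prefix-↾ x L k (<⇒≤ k<L)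
    bound : code (x ↾ k) < len C
    bound = subst (code (x ↾ k) <_) (sym (len-applyUpTo y n)) (≤-<-trans (code-mono x (<⇒≤ k<L)) j<n)
    nth≡ : nth j k ≡ nth C (prefix j k)
    nth≡ = begin
      nth j k                ≡⟨ nth-applyUpTo x L k k<L ⟩
      x k                    ≡⟨ consistent a ⟩
      y (code (x ↾ k))       ≡⟨ nth-applyUpTo y n (code (x ↾ k)) (subst (code (x ↾ k) <_) (len-applyUpTo y n) bound) ⟨
      nth C (code (x ↾ k))   ≡⟨ cong (nth C) prefix≡ ⟨
      nth C (prefix j k)     ∎

followMove : ℕ → Baire → ℕ → List ℕ → ℕ
followMove j y m u = if m <ᵇ len j then nth j m else y (code u)

followThen : ℕ → Baire → Baire
followThen j y = play (followMove j y)

followThen-inside : ∀ j y m → m < len j → followThen j y m ≡ nth j m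
followThen-inside j y m m<len =
  cong (if_then nth j m else y (code (position (followMove j y) m))) (T⇒≡ (<⇒<ᵇ m<len))

followThen-outside : ∀ j y m → ¬ (m < len j) → followThen j y m ≡ y (code (followThen j y ↾ m))
followThen-outside j y m m≮len = begin
  followThen j y m                                ≡⟨ cong (if_then nth j m else y (code (position (followMove j y) m)))
                                                        (¬T⇒≡ (λ t → m≮len (<ᵇ⇒< m (len j) t))) ⟩
  y (code (position (followMove j y) m))         ≡⟨ cong (λ u → y (code u)) (position-play (followMove j y) m) ⟩
  y (code (followThen j y ↾ m))                  ∎

followThen-↾ : ∀ j y k → k ≤ len j → followThen j y ↾ k ≡ applyUpTo (nth j) k
followThen-↾ j y k k≤len = applyUpTo-cong k (λ m m<k → followThen-inside j y m (<-≤-trans m<k k≤len))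

followThen-consistent : ∀ y j n → T (Conforms j (code (y ↾ n))) → P2Consistent (decodeStrat y) (followThen j y)
followThen-consistent y j n conf a with suc (2 * a) <? len j
... | no  k≮len = followThen-outside j y (suc (2 * a)) k≮len
... | yes k<len = begin
  x k                     ≡⟨ followThen-inside j y k k<len ⟩
  nth j k                 ≡⟨ proj₂ agree ⟩
  nth C (prefix j k)      ≡⟨ nth-applyUpTo y n (prefix j k) (subst (prefix j k <_) (len-applyUpTo y n) (proj₁ agree)) ⟩
  y (prefix j k)          ≡⟨ cong (λ u → y (code u)) (followThen-↾ j y k (<⇒≤ k<len)) ⟨
  y (code (x ↾ k))        ∎
  where
  x : Baire
  x = followThen j y
  k : ℕ
  k = suc (2 * a)
  C : ℕ
  C = code (y ↾ n)
  agree : AgreesAt j C k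
  agree = conforms-elim j C conf a k<len

Enters : Baire → ℕ → ℕ → ℕ → Bool
Enters α i j c = (0 <ᵇ α i) ∧ ((len (pred (α i)) <ᵇ suc (len j)) ∧
                 ((prefix j (len (pred (α i))) ≡ᵇ pred (α i)) ∧ Conforms j c))

Refuted : Baire → ℕ → Bool
Refuted α c = anyUpTo (len c) (λ j → anyUpTo (len c) (λ i → Enters α i j c))

iRefuted : Impl 1 (λ α xs → char (Refuted α (arg₀ xs)))
iRefuted = ap2 (iany (ap3 (iany iEnters) (ap1 ilen v1) v0 v1)) (ap1 ilen v0) v0
  where
  iConforms : Impl 2 (λ _ xs → char (Conforms (arg₀ xs) (arg₁ xs)))
  iConforms = ap3 (iall iConformsAt) (ap1 ilen v0) v0 v1
    where
    iConformsAt : Impl 3 (λ _ xs → char (ConformsAt (arg₀ xs) (arg₁ xs) (arg₂ xs)))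
    iConformsAt = ior (ap2 ieq (ap1 ipar v0) izer)
                      (iand (ap2 ieq (ap2 inth v1 v0) (ap2 inth v2 (ap2 iprefix v1 v0)))
                            (ap2 ilt (ap2 iprefix v1 v0) (ap1 ilen v2)))
  iEnters : Impl 3 (λ α xs → char (Enters α (arg₀ xs) (arg₁ xs) (arg₂ xs)))
  iEnters = iand (ap2 ilt izer (ap1 iorc v0))
              (iand (ap2 ilt (ap1 ilen (ap1 ipred (ap1 iorc v0))) (ap1 isc (ap1 ilen v1)))
                 (iand (ap2 ieq (ap2 iprefix v1 (ap1 ilen (ap1 ipred (ap1 iorc v0)))) (ap1 ipred (ap1 iorc v0)))
                       (ap2 iConforms v1 v2)))

enters-elim : ∀ α i j c → T (Enters α i j c) →
              Σ ℕ λ w → α i ≡ suc w × len w ≤ len j × prefix j (len w) ≡ w × T (Conforms j c)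
enters-elim α i j c h with α i in αi≡
... | zero  = ⊥-elim h
... | suc w = let (short , rest)   = ∧-elim (len w <ᵇ suc (len j)) h
                  (is-prefix , conf) = ∧-elim (prefix j (len w) ≡ᵇ w) rest
              in w , refl , ≤-pred (<ᵇ⇒< _ _ short) , ≡ᵇ⇒≡ _ _ is-prefix , conf

enters-intro : ∀ α i j c w → α i ≡ suc w → len w ≤ len j → prefix j (len w) ≡ w → T (Conforms j c) →
               T (Enters α i j c)
enters-intro α i j c w αi≡ short is-prefix conf rewrite αi≡ =
  ∧-intro (len w <ᵇ suc (len j)) (<⇒<ᵇ (s≤s short)) (∧-intro (prefix j (len w) ≡ᵇ w) (≡⇒≡ᵇ _ _ is-prefix) conf)

refuted-elim : ∀ α c → T (Refuted α c) →
               Σ ℕ λ j → Σ ℕ λ i → j < len c × i < len c × T (Enters α i j c)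
refuted-elim α c h =
  let (j , j<len , hj) = any-elim (len c) _ h
      (i , i<len , hi) = any-elim (len c) _ hj
  in j , i , j<len , i<len , hi

refuted-intro : ∀ α c j i → j < len c → i < len c → T (Enters α i j c) → T (Refuted α c)
refuted-intro α c j i j<len i<len h = any-intro (len c) _ j j<len (any-intro (len c) _ i i<len h)

refuted-mono : ∀ α s t → T (Refuted α (code s)) → T (Refuted α (code (s ++ t)))
refuted-mono α s t h =
  let (j , i , j<len , i<len , enters)     = refuted-elim α (code s) h
      (w , αi≡ , short , is-prefix , conf) = enters-elim α i j (code s) enters
  in refuted-intro α c' j i (<-≤-trans j<len len≤) (<-≤-trans i<len len≤)
       (enters-intro α i j c' w αi≡ short is-prefix (conforms-mono j conf))
  where
  c' : ℕ
  c' = code (s ++ t)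
  len≤ : len (code s) ≤ len c'
  len≤ = subst₂ _≤_ (sym (len-code s)) (sym (len-code (s ++ t)))
                (subst (length s ≤_) (sym (length-++ s)) (m≤m+n _ _))
  entry-++ : ∀ k → k < length s → nth (code s) k ≡ nth c' k
  entry-++ k k<len = begin
    nth (code s) k   ≡⟨ nth-code s k ⟩
    at s k           ≡⟨ at-++ s t k k<len ⟨
    at (s ++ t) k    ≡⟨ nth-code (s ++ t) k ⟨
    nth c' k         ∎
  conforms-mono : ∀ j → T (Conforms j (code s)) → T (Conforms j c')
  conforms-mono j conf = conforms-intro j c' λ a k<len →
    let (lt , eq) = conforms-elim j (code s) conf a k<len
    in <-≤-trans lt len≤ ,
       trans eq (entry-++ (prefix j (suc (2 * a))) (subst (prefix j (suc (2 * a)) <_) (len-code s) lt))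

-- The tree of unrefuted strategy prefixes for an enumeration p of W: its
-- paths are exactly the points coding winning strategies of Player 2.
module StrategyTree (p : Baire) (W : Baire → Set) (names : Names OpenSp p W) where

  Tree : List ℕ → Bool
  Tree s = not (Refuted p (code s))

  isTree : IsTree Tree
  isTree s t in-tree = ¬T⇒not≡true (λ refuted → not≡true⇒¬T in-tree (refuted-mono p s t refuted))

  -- A play consistent with a path y cannot enter W: the position at which
  -- it enters refutes a long enough prefix of y.
  path⇒winning : ∀ y → IsPath Tree y → P2Winning W (decodeStrat y)
  path⇒winning y path x consistent wx with proj₁ (names x) wx
  ... | (i , w , pi≡ , w≺x) = not≡true⇒¬T (path n) refuted
    where
    L : ℕ
    L = length w
    j : ℕ
    j = code (x ↾ L)
    n : ℕ
    n = suc (j + i)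
    C : ℕ
    C = code (y ↾ n)
    short : len (code w) ≤ len j
    short = ≤-reflexive (trans (len-code w) (sym (len-applyUpTo x L)))
    is-prefix : prefix j (len (code w)) ≡ code w
    is-prefix = trans (cong (prefix j) (len-code w)) (trans (prefix-↾ x L L ≤-refl) (cong code (sym w≺x)))
    below-n : ∀ {k} → k < n → k < len C
    below-n {k} = subst (k <_) (sym (len-applyUpTo y n))
    refuted : T (Refuted p C)
    refuted = refuted-intro p C j i (below-n (s≤s (m≤m+n j i))) (below-n (s≤s (m≤n+m i j)))
                (enters-intro p i j C (code w) pi≡ short is-prefix
                   (consistent-conforms y x consistent L n (s≤s (m≤m+n j i))))

  refutation-play : ∀ y n → T (Refuted p (code (y ↾ n))) → Σ Baire λ x → P2Consistent (decodeStrat y) x × W x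
  refutation-play y n refuted with refuted-elim p (code (y ↾ n)) refuted
  ... | (j , i , _ , _ , enters) with enters-elim p i j (code (y ↾ n)) enters
  ... | (w , pi≡ , short , is-prefix , conf) =
    x , followThen-consistent y j n conf , proj₂ (names x) (i , u , pi≡u , u≺x)
    where
    x : Baire
    x = followThen j y
    u : List ℕ
    u = applyUpTo (nth j) (len w)
    pi≡u : p i ≡ suc (code u)
    pi≡u = trans pi≡ (cong suc (sym is-prefix))
    u≺x : u ≺ x
    u≺x = trans (sym (followThen-↾ j y (len w) short)) (cong (x ↾_) (sym (length-applyUpTo (nth j) (len w))))

  winning⇒path : ∀ y → P2Winning W (decodeStrat y) → IsPath Tree y
  winning⇒path y wins n = ¬T⇒not≡true λ refuted →
    let (x , consistent , wx) = refutation-play y n refuted in wins x consistent wx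

-- From (a name of) W compute the tree; a path is (a name of) a winning
-- strategy.  The tree has a path since open games are determined.
findWS≤C : ExcludedMiddle 0ℓ → FindWS-Π ≤W C-Baire
findWS≤C em = ≤W-intro {f = FindWS-Π} {g = C-Baire}
  (λ p c → char (not (Refuted p c))) (λ α n → α (suc (2 * n))) (inot iRefuted) iodd
  λ W noP1 p names →
    let open StrategyTree p W names
        open OpenDeterminacy em W
        y₀ : Baire
        y₀ = encodeStrat σsafe
        y₀-wins : P2Winning W (decodeStrat y₀)
        y₀-wins = σsafe-wins (named-isOpen names) noP1 (decodeStrat y₀) (decode-encode σsafe)
    in Tree , (isTree , y₀ , winning⇒path y₀ y₀-wins) , (λ s → refl) ,
       λ y r path r≡y → y , path⇒winning y path , λ n → trans (interleave-odd p r n) (r≡y n)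

p2Moves : ℕ → ℕ
p2Moves i = code (applyUpTo (λ m → nth i (suc (2 * m))) (half (len i)))

p2Moves-≺ : ∀ w x → w ≺ x → p2Moves (code w) ≡ code (applyUpTo (λ m → x (suc (2 * m))) (half (length w)))
p2Moves-≺ w x w≺x = begin
  code (applyUpTo (λ m → nth (code w) (suc (2 * m))) (half (len (code w))))
    ≡⟨ cong (λ L → code (applyUpTo (λ m → nth (code w) (suc (2 * m))) (half L))) (len-code w) ⟩
  code (applyUpTo (λ m → nth (code w) (suc (2 * m))) (half (length w)))
    ≡⟨ cong code (applyUpTo-cong (half (length w)) (λ m m<half →
         trans (nth-code w (suc (2 * m))) (≺-at (suc (2 * m)) w≺x (half-bound m (length w) m<half)))) ⟩
  code (applyUpTo (λ m → x (suc (2 * m))) (half (length w))) ∎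

leaveTree : Baire → Baire
leaveTree p i = ite (char (p (p2Moves i) ≡ᵇ 0)) (suc i) 0

ileaveTree : Impl 1 (λ α xs → leaveTree α (arg₀ xs))
ileaveTree = ap3 iite (ap2 ieq (ap1 iorc ip2Moves) izer) (ap1 isc v0) izer
  where ip2Moves : Impl 1 (λ _ xs → p2Moves (arg₀ xs))
        ip2Moves = ap2 (icode (ap2 inth v1 (ap1 iodd-index v0))) (ap1 ihalf ilen) v0

leaveTree-elim : ∀ p i w → leaveTree p i ≡ suc (code w) → i ≡ code w × p (p2Moves i) ≡ 0
leaveTree-elim p i w e with p (p2Moves i) ≡ᵇ 0 in eq
... | true  = suc-injective e , ≡ᵇ⇒≡ (p (p2Moves i)) 0 (subst T (sym eq) tt)
... | false = ⊥-elim (0≢1+n e)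

leaveTree-intro : ∀ p i → p (p2Moves i) ≡ 0 → leaveTree p i ≡ suc i
leaveTree-intro p i p≡0 = cong (λ v → ite (char (v ≡ᵇ 0)) (suc i) 0) p≡0

NamedBy : Baire → Baire → Set
NamedBy q x = Σ ℕ λ i → Σ (List ℕ) λ w → (q i ≡ suc (code w)) × (w ≺ x)

-- The play in which Player 1 always plays 0 and Player 2 answers by the
-- strategy coded by the odd part of α: zeroPlay α n codes its first 2n
-- moves and reply α n is Player 2's n-th move.
zeroPlay : Baire → ℕ → ℕ
zeroPlay α zero    = 0
zeroPlay α (suc n) = snoc (snoc (zeroPlay α n) 0) (α (suc (2 * snoc (zeroPlay α n) 0)))

reply : Baire → ℕ → ℕ
reply α n = α (suc (2 * snoc (zeroPlay α n) 0))

ireply : Impl 1 (λ α xs → reply α (arg₀ xs))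
ireply = ap1 iodd (ap2 isnoc izeroPlay izer)
  where izeroPlay : Impl 1 (λ α xs → zeroPlay α (arg₀ xs))
        izeroPlay = iprec _ izer (ap2 isnoc (ap2 isnoc v1 izer) (ap1 iodd (ap2 isnoc v1 izer)))
                      (λ _ _ → refl) (λ { _ k [] → refl })

module ZeroPlay (z α : Baire) (α-odd : ∀ m → α (suc (2 * m)) ≡ z m) where

  x : Baire
  x = evenOdd (λ _ → 0) (reply α)

  zeroPlay-↾ : ∀ n → zeroPlay α n ≡ code (x ↾ (2 * n))
  after-0 : ∀ n → snoc (zeroPlay α n) 0 ≡ code (x ↾ suc (2 * n))
  after-0 n = begin
    snoc (zeroPlay α n) 0                   ≡⟨ cong (λ c → snoc c 0) (zeroPlay-↾ n) ⟩
    snoc (code (x ↾ (2 * n))) 0             ≡⟨ snoc-code (x ↾ (2 * n)) 0 ⟩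
    code ((x ↾ (2 * n)) ∷ʳ 0)
      ≡⟨ cong (λ m → code ((x ↾ (2 * n)) ∷ʳ m)) (evenOdd-even (λ _ → 0) (reply α) n) ⟨
    code ((x ↾ (2 * n)) ∷ʳ x (2 * n))       ≡⟨ cong code (↾-suc x (2 * n)) ⟨
    code (x ↾ suc (2 * n))                  ∎
  zeroPlay-↾ zero    = refl
  zeroPlay-↾ (suc n) = begin
    snoc (snoc (zeroPlay α n) 0) (reply α n)       ≡⟨ cong (λ c → snoc c (reply α n)) (after-0 n) ⟩
    snoc (code (x ↾ suc (2 * n))) (reply α n)      ≡⟨ snoc-code (x ↾ suc (2 * n)) (reply α n) ⟩
    code ((x ↾ suc (2 * n)) ∷ʳ reply α n)
      ≡⟨ cong (λ m → code ((x ↾ suc (2 * n)) ∷ʳ m)) (evenOdd-odd (λ _ → 0) (reply α) n) ⟨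
    code ((x ↾ suc (2 * n)) ∷ʳ x (suc (2 * n)))    ≡⟨ cong code (↾-suc x (suc (2 * n))) ⟨
    code (x ↾ suc (suc (2 * n)))                   ≡⟨ cong (λ k → code (x ↾ k)) (*-suc 2 n) ⟨
    code (x ↾ (2 * suc n))                         ∎

  consistent : P2Consistent (decodeStrat z) x
  consistent n = begin
    x (suc (2 * n))                  ≡⟨ evenOdd-odd (λ _ → 0) (reply α) n ⟩
    α (suc (2 * snoc (zeroPlay α n) 0)) ≡⟨ α-odd (snoc (zeroPlay α n) 0) ⟩
    z (snoc (zeroPlay α n) 0)        ≡⟨ cong z (after-0 n) ⟩
    z (code (x ↾ suc (2 * n)))       ∎

  p2Moves-zeroPlay : ∀ n → p2Moves (code (x ↾ (2 * n))) ≡ code (reply α ↾ n)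
  p2Moves-zeroPlay n = begin
    p2Moves (code (x ↾ (2 * n)))
      ≡⟨ p2Moves-≺ (x ↾ (2 * n)) x (≺-↾ x (2 * n)) ⟩
    code (applyUpTo (λ m → x (suc (2 * m))) (half (length (x ↾ (2 * n)))))
      ≡⟨ cong (λ L → code (applyUpTo (λ m → x (suc (2 * m))) (half L))) (length-applyUpTo x (2 * n)) ⟩
    code (applyUpTo (λ m → x (suc (2 * m))) (half (2 * n)))
      ≡⟨ cong (λ L → code (applyUpTo (λ m → x (suc (2 * m))) L)) (half-even n) ⟩
    code (applyUpTo (λ m → x (suc (2 * m))) n)
      ≡⟨ cong code (applyUpTo-cong n (λ m _ → evenOdd-odd (λ _ → 0) (reply α) m)) ⟩
    code (reply α ↾ n) ∎

module TreeGame (Tr : List ℕ → Bool) (p : Baire) (p-names : ∀ s → p (code s) ≡ char (Tr s)) where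

  W : Baire → Set
  W = NamedBy (leaveTree p)

  against : Strategy → Baire → ℕ → List ℕ → ℕ
  against σ y n u = evenOdd (λ _ → σ u) y n

  -- A play whose Player 2 moves follow a path y never leaves the tree, so
  -- no strategy of Player 1 wins.
  path⇒P1-loses : ∀ y → IsPath Tr y → ¬ (Σ Strategy λ σ → P1Winning W σ)
  path⇒P1-loses y path (σ , σ-wins) with σ-wins (play (against σ y)) follows-σ
    where
    follows-σ : P1Consistent σ (play (against σ y))
    follows-σ a = trans (evenOdd-even (λ _ → σ (position (against σ y) (2 * a))) y a)
                        (cong σ (position-play (against σ y) (2 * a)))
  ... | (i , w , e , w≺x) = 1+n≢0 (begin
    1                                ≡⟨ cong char (path K) ⟨
    char (Tr (y ↾ K))                ≡⟨ p-names (y ↾ K) ⟨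
    p (code (y ↾ K))                 ≡⟨ cong (λ u → p (code u)) (applyUpTo-cong K (λ m _ → sym (x-odd m))) ⟩
    p (code (applyUpTo (λ m → x (suc (2 * m))) K)) ≡⟨ cong p (p2Moves-≺ w x w≺x) ⟨
    p (p2Moves (code w))             ≡⟨ cong (λ v → p (p2Moves v)) (proj₁ left) ⟨
    p (p2Moves i)                    ≡⟨ proj₂ left ⟩
    0                                ∎)
    where
    x : Baire
    x = play (against σ y)
    x-odd : ∀ a → x (suc (2 * a)) ≡ y a
    x-odd a = evenOdd-odd (λ _ → σ (position (against σ y) (suc (2 * a)))) y a
    K : ℕ
    K = half (length w)
    left : i ≡ code w × p (p2Moves i) ≡ 0
    left = leaveTree-elim p i w e

  -- Player 2's replies to the constant-0 play of Player 1 form a path: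
  -- otherwise that play leaves the tree after 2n moves, so it lies in W.
  winning⇒path : ∀ z α → (∀ m → α (suc (2 * m)) ≡ z m) → P2Winning W (decodeStrat z) → IsPath Tr (reply α)
  winning⇒path z α α-odd wins n with Tr (reply α ↾ n) in eq
  ... | true  = refl
  ... | false = ⊥-elim (wins x consistent (code w , w , enumerated , ≺-↾ x (2 * n)))
    where
    open ZeroPlay z α α-odd
    w : List ℕ
    w = x ↾ (2 * n)
    enumerated : leaveTree p (code w) ≡ suc (code w)
    enumerated = leaveTree-intro p (code w)
      (trans (cong p (p2Moves-zeroPlay n)) (trans (p-names (reply α ↾ n)) (cong char eq)))

C≤findWS : C-Baire ≤W FindWS-Π
C≤findWS = ≤W-intro {f = C-Baire} {g = FindWS-Π} leaveTree reply ileaveTree ireply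
  λ { Tr (_ , y , path) p p-names →
    let open TreeGame Tr p p-names
    in W , path⇒P1-loses y path , (λ x → (λ wx → wx) , (λ wx → wx)) ,
       λ z r wins r≡z → reply ⟨ p , r ⟩ ,
         winning⇒path z ⟨ p , r ⟩ (λ m → trans (interleave-odd p r m) (r≡z m)) wins , (λ n → refl) }

proposition6p19 : ExcludedMiddle 0ℓ → FindWS-Π ≡W C-Baire
proposition6p19 em = findWS≤C em , C≤findWS
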